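{- Let $P_1, P_2 \in \mathcal{P}_{\mathrm{reach}}$. Then: (1) if $P_1 \sim P_2$ for some $\sim\ \in \{\sim_{\rm FB}, \sim_{\rm FB:ps}, \sim_{\rm FRB}\}$, then $\mathrm{frs}(P_1) = \mathrm{frs}(P_2)$; (2) if $P_1 \sim P_2$ for some $\sim\ \in \{\sim_{\rm RB}, \sim_{\rm FRB}\}$, then $\mathrm{brs}(P_1) = \mathrm{brs}(P_2)$.
   Context: Fix a countable set $A$ of actions containing an unobservable action $\tau$. Process terms are generated by $P ::= \mathbf{0} \mid a\,.\,P \mid a^{\dagger}.\,P \mid P + P \mid P \parallel_L P$ with $a \in A$ and $L \subseteq A \setminus \{\tau\}$; $a^\dagger$ marks an already executed action, and $P_1 \parallel_L P_2$ is CSP-style parallel composition (independent on actions outside $L$, synchronizing on actions in $L$). The predicate $\mathrm{initial}$ is the least one with: $\mathrm{initial}(\mathbf{0})$; $\mathrm{initial}(a.P)$ if $\mathrm{initial}(P)$; $\mathrm{initial}(P_1+P_2)$ and $\mathrm{initial}(P_1 \parallel_L P_2)$ if $\mathrm{initial}(P_1)\wedge \mathrm{initial}(P_2)$ (so no term containing a $\dagger$ is initial). The predicate $\mathrm{wf}$ is the least one with: $\mathrm{wf}(\mathbf{0})$; $\mathrm{wf}(a.P)$ if $\mathrm{initial}(P)$; $\mathrm{wf}(a^\dagger.P)$ if $\mathrm{wf}(P)$; $\mathrm{wf}(P_1+P_2)$ if $(\mathrm{wf}(P_1)\wedge\mathrm{initial}(P_2))\vee(\mathrm{initial}(P_1)\wedge\mathrm{wf}(P_2))$;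 $\mathrm{wf}(P_1\parallel_L P_2)$ if $\mathrm{wf}(P_1)\wedge\mathrm{wf}(P_2)$. Proof terms: $\theta ::= a \mid .\theta \mid +_l\theta \mid +_r\theta \mid \parallel_l\theta \mid \parallel_r\theta \mid \langle\theta,\theta\rangle$. The partial function $\mathrm{act}$ is: $\mathrm{act}(a)=a$; $\mathrm{act}(.\theta)=\mathrm{act}(+_l\theta)=\mathrm{act}(+_r\theta)=\mathrm{act}(\parallel_l\theta)=\mathrm{act}(\parallel_r\theta)=\mathrm{act}(\theta)$; $\mathrm{act}(\langle\theta_1,\theta_2\rangle)=\mathrm{act}(\theta_1)$ if $\mathrm{act}(\theta_1)=\mathrm{act}(\theta_2)$. The transition relation $\xrightarrow{\theta}$ on well-formed processes is the least one closed under: $a.P \xrightarrow{a} a^\dagger.P$ if $\mathrm{initial}(P)$; if $P\xrightarrow{\theta}P'$ then $a^\dagger.P \xrightarrow{.\theta} a^\dagger.P'$; if $P_1\xrightarrow{\theta}P_1'$ and $\mathrm{initial}(P_2)$ then $P_1+P_2\xrightarrow{+_l\theta}P_1'+P_2$; if $P_2\xrightarrow{\theta}P_2'$ and $\mathrm{initial}(P_1)$ then $P_1+P_2\xrightarrow{+_r\theta}P_1+P_2'$; if $P_1\xrightarrow{\theta}P_1'$ and $\mathrm{act}(\theta)\notin L$ then $P_1\parallel_L P_2\xrightarrow{\parallel_l\theta}P_1'\parallel_L P_2$; symmetrically $P_1\parallel_L P_2\xrightarrow{\parallel_r\theta}P_1\parallel_L P_2'$ if $P_2\xrightarrow{\theta}P_2'$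 and $\mathrm{act}(\theta)\notin L$; if $P_1\xrightarrow{\theta_1}P_1'$, $P_2\xrightarrow{\theta_2}P_2'$ and $\mathrm{act}(\theta_1)=\mathrm{act}(\theta_2)\in L$ then $P_1\parallel_L P_2\xrightarrow{\langle\theta_1,\theta_2\rangle}P_1'\parallel_L P_2'$. $\mathcal{P}_{\mathrm{reach}}$ is the set of processes reachable via these transitions from some initial process. A symmetric relation $\mathcal{B}$ over $\mathcal{P}_{\mathrm{reach}}$ is a forward bisimulation if whenever $(P_1,P_2)\in\mathcal{B}$, for each $P_1\xrightarrow{\theta_1}P_1'$ there is $P_2\xrightarrow{\theta_2}P_2'$ with $\mathrm{act}(\theta_1)=\mathrm{act}(\theta_2)$ and $(P_1',P_2')\in\mathcal{B}$; it is a reverse bisimulation if whenever $(P_1,P_2)\in\mathcal{B}$, for each $P_1'\xrightarrow{\theta_1}P_1$ there is $P_2'\xrightarrow{\theta_2}P_2$ with $\mathrm{act}(\theta_1)=\mathrm{act}(\theta_2)$ and $(P_1',P_2')\in\mathcal{B}$; it is a forward-reverse bisimulation if both clauses hold; it is a past-sensitive forward bisimulation if it is a forward bisimulation and $\mathrm{initial}(P_1)\Leftrightarrow\mathrm{initial}(P_2)$ for all $(P_1,P_2)\in\mathcal{B}$. $\sim_{\rm FB}$, $\sim_{\rm RB}$, $\sim_{\rm FRB}$, $\sim_{\rm FB:ps}$ denote the unions of all forward, reverse, forward-reverse, and past-sensitive forward bisimulations respectively. Forward and backward ready sets ($\bar L = A\setminus L$): $\mathrm{frs}(\mathbf{0})=\mathrm{brs}(\mathbf{0})=\emptyset$;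 $\mathrm{frs}(a.P)=\{a\}$, $\mathrm{brs}(a.P)=\emptyset$; $\mathrm{frs}(a^\dagger.P)=\mathrm{frs}(P)$, $\mathrm{brs}(a^\dagger.P)=\{a\}$ if $\mathrm{initial}(P)$ and $\mathrm{brs}(P)$ otherwise; $\mathrm{frs}(P_1+P_2)$ equals $\mathrm{frs}(P_1)\cup\mathrm{frs}(P_2)$ if both initial, $\mathrm{frs}(P_1)$ if only $P_2$ is initial, $\mathrm{frs}(P_2)$ if only $P_1$ is initial; $\mathrm{brs}(P_1+P_2)$ equals $\emptyset$ if both initial, $\mathrm{brs}(P_1)$ if only $P_2$ is initial, $\mathrm{brs}(P_2)$ if only $P_1$ is initial; $\mathrm{frs}(P_1\parallel_L P_2)=(\mathrm{frs}(P_1)\cap\bar L)\cup(\mathrm{frs}(P_2)\cap\bar L)\cup(\mathrm{frs}(P_1)\cap\mathrm{frs}(P_2)\cap L)$, and $\mathrm{brs}(P_1\parallel_L P_2)$ is defined the same way with $\mathrm{brs}$ in place of $\mathrm{frs}$. -}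

module Defs where

open import Data.Bool using (Bool; true; false; _∧_)
open import Data.Empty using (⊥)
open import Data.Nat using (ℕ)
open import Data.Product using (Σ; ∃; _×_; _,_)
open import Data.Sum using (_⊎_)
open import Relation.Nullary using (¬_)
open import Relation.Binary.PropositionalEquality using (_≡_)
open import Function.Definitions using (Injective)

Countable : Set → Set
Countable A = Σ (A → ℕ) (Injective _≡_ _≡_)

-- Everything is parametrised by the action set A and the unobservable action τ.
module Theory (A : Set) (τ : A) where

  ASet : Set₁
  ASet = A → Set

  -- process terms; the synchronisation set L must satisfy L ⊆ A ∖ {τ}
  data Proc : Set₁ where
    𝟎    : Proc
    pre  : A → Proc → Proc
    done : A → Proc → Proc                       -- a† . P
    _⊕_  : Proc → Proc → Proc
    par  : Proc → (L : ASet) → ¬ L τ → Proc → Proc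

  -- initial, as a (decidable) boolean function; equivalent to the least predicate
  initial : Proc → Bool
  initial 𝟎 = true
  initial (pre a P) = initial P
  initial (done a P) = false
  initial (P ⊕ Q) = initial P ∧ initial Q
  initial (par P L _ Q) = initial P ∧ initial Q

  Initial : Proc → Set
  Initial P = initial P ≡ true

  data WF : Proc → Set₁ where
    wf𝟎    : WF 𝟎
    wfpre  : ∀ {a P} → Initial P → WF (pre a P)
    wfdone : ∀ {a P} → WF P → WF (done a P)
    wf⊕l   : ∀ {P Q} → WF P → Initial Q → WF (P ⊕ Q)
    wf⊕r   : ∀ {P Q} → Initial P → WF Q → WF (P ⊕ Q)
    wfpar  : ∀ {P Q L h} → WF P → WF Q → WF (par P L h Q)

  data PT : Set where
    act   : A → PT
    dot   : PT → PT
    +l +r : PT → PT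
    ∥l ∥r : PT → PT
    ⟨_,_⟩ : PT → PT → PT

  -- the partial function act, as its graph: Act θ a  means  act(θ) = a
  data Act : PT → A → Set where
    act-a   : ∀ {a} → Act (act a) a
    act-dot : ∀ {θ a} → Act θ a → Act (dot θ) a
    act-+l  : ∀ {θ a} → Act θ a → Act (+l θ) a
    act-+r  : ∀ {θ a} → Act θ a → Act (+r θ) a
    act-∥l  : ∀ {θ a} → Act θ a → Act (∥l θ) a
    act-∥r  : ∀ {θ a} → Act θ a → Act (∥r θ) a
    act-⟨⟩  : ∀ {θ₁ θ₂ a} → Act θ₁ a → Act θ₂ a → Act ⟨ θ₁ , θ₂ ⟩ a

  ActNotIn : PT → ASet → Set
  ActNotIn θ L = Σ A λ a → Act θ a × ¬ L a

  data Step : Proc → PT → Proc → Set₁ where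
    s-pre  : ∀ {a P} → Initial P → Step (pre a P) (act a) (done a P)
    s-done : ∀ {a P θ P'} → Step P θ P' → Step (done a P) (dot θ) (done a P')
    s-+l   : ∀ {P₁ P₂ θ P₁'} → Step P₁ θ P₁' → Initial P₂ → Step (P₁ ⊕ P₂) (+l θ) (P₁' ⊕ P₂)
    s-+r   : ∀ {P₁ P₂ θ P₂'} → Step P₂ θ P₂' → Initial P₁ → Step (P₁ ⊕ P₂) (+r θ) (P₁ ⊕ P₂')
    s-∥l   : ∀ {P₁ P₂ L h θ P₁'} → Step P₁ θ P₁' → ActNotIn θ L →
             Step (par P₁ L h P₂) (∥l θ) (par P₁' L h P₂)
    s-∥r   : ∀ {P₁ P₂ L h θ P₂'} → Step P₂ θ P₂' → ActNotIn θ L →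
             Step (par P₁ L h P₂) (∥r θ) (par P₁ L h P₂')
    s-sync : ∀ {P₁ P₂ L h θ₁ θ₂ P₁' P₂' a} → Step P₁ θ₁ P₁' → Step P₂ θ₂ P₂' →
             Act θ₁ a → Act θ₂ a → L a →
             Step (par P₁ L h P₂) ⟨ θ₁ , θ₂ ⟩ (par P₁' L h P₂')

  data Steps : Proc → Proc → Set₁ where
    ε   : ∀ {P} → Steps P P
    _◅_ : ∀ {P θ Q R} → Step P θ Q → Steps Q R → Steps P R

  Reach : Proc → Set₁
  Reach P = Σ Proc λ P₀ → Initial P₀ × Steps P₀ P

  SameAct : PT → PT → Set
  SameAct θ₁ θ₂ = Σ A λ a → Act θ₁ a × Act θ₂ a

  Rel : Set₂
  Rel = Proc → Proc → Set₁

  IsRelOnReach : Rel → Set₁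
  IsRelOnReach B = (∀ {P Q} → B P Q → Reach P × Reach Q) × (∀ {P Q} → B P Q → B Q P)

  ForwardClause : Rel → Set₁
  ForwardClause B = ∀ {P₁ P₂} → B P₁ P₂ → ∀ {θ₁ P₁'} → Step P₁ θ₁ P₁' →
    Σ PT λ θ₂ → Σ Proc λ P₂' → Step P₂ θ₂ P₂' × SameAct θ₁ θ₂ × B P₁' P₂'

  ReverseClause : Rel → Set₁
  ReverseClause B = ∀ {P₁ P₂} → B P₁ P₂ → ∀ {θ₁ P₁'} → Step P₁' θ₁ P₁ →
    Σ PT λ θ₂ → Σ Proc λ P₂' → Step P₂' θ₂ P₂ × SameAct θ₁ θ₂ × B P₁' P₂'

  PastSensitive : Rel → Set₁
  PastSensitive B = ∀ {P₁ P₂} → B P₁ P₂ → initial P₁ ≡ initial P₂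

  IsFB IsRB IsFRB IsFBps : Rel → Set₁
  IsFB B   = IsRelOnReach B × ForwardClause B
  IsRB B   = IsRelOnReach B × ReverseClause B
  IsFRB B  = IsRelOnReach B × ForwardClause B × ReverseClause B
  IsFBps B = IsFB B × PastSensitive B

  _∼FB_ _∼RB_ _∼FRB_ _∼FBps_ : Proc → Proc → Set₂
  P ∼FB Q   = Σ Rel λ B → IsFB B × B P Q
  P ∼RB Q   = Σ Rel λ B → IsRB B × B P Q
  P ∼FRB Q  = Σ Rel λ B → IsFRB B × B P Q
  P ∼FBps Q = Σ Rel λ B → IsFBps B × B P Q

  ∅ : ASet
  ∅ _ = ⊥

  _∪_ _∩_ : ASet → ASet → ASet
  (X ∪ Y) a = X a ⊎ Y a
  (X ∩ Y) a = X a × Y a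

  ∁ : ASet → ASet
  ∁ X a = ¬ X a

  _≐_ : ASet → ASet → Set
  X ≐ Y = ∀ a → (X a → Y a) × (Y a → X a)

  -- choice helper for P₁ + P₂ (case both non-initial does not occur for wf terms; ∅)
  sumCase : Bool → Bool → ASet → ASet → ASet → ASet
  sumCase true  true  both _  _  = both
  sumCase false true  _    s₁ _  = s₁
  sumCase true  false _    _  s₂ = s₂
  sumCase false false _    _  _  = ∅

  parRS : ASet → ASet → ASet → ASet
  parRS X₁ X₂ L = (X₁ ∩ ∁ L) ∪ ((X₂ ∩ ∁ L) ∪ ((X₁ ∩ X₂) ∩ L))

  frs : Proc → ASet
  frs 𝟎 = ∅
  frs (pre a P) = λ b → b ≡ a
  frs (done a P) = frs P
  frs (P₁ ⊕ P₂) = sumCase (initial P₁) (initial P₂) (frs P₁ ∪ frs P₂) (frs P₁) (frs P₂)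
  frs (par P₁ L _ P₂) = parRS (frs P₁) (frs P₂) L

  brsDone : Bool → A → ASet → ASet
  brsDone true  a _ = λ b → b ≡ a
  brsDone false _ X = X

  brs : Proc → ASet
  brs 𝟎 = ∅
  brs (pre a P) = ∅
  brs (done a P) = brsDone (initial P) a (brs P)
  brs (P₁ ⊕ P₂) = sumCase (initial P₁) (initial P₂) ∅ (brs P₁) (brs P₂)
  brs (par P₁ L _ P₂) = parRS (brs P₁) (brs P₂) L

-- For a reachable (hence well-formed) process, a ∈ frs P holds exactly when P can
-- perform a forward transition labelled a, and a ∈ brs P exactly when some
-- transition labelled a leads into P. A forward (resp. reverse) bisimulation
-- matches every outgoing (resp. incoming) transition by one with the same action,
-- so it preserves these sets of enabled actions, hence frs (resp. brs).

module Submission where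

open import Defs
open import Data.Bool using (true; false; _∧_)
open import Data.Bool.Properties using (∧-zeroʳ)
open import Data.Product using (Σ; ∃; _×_; _,_; proj₁; proj₂; map)
open import Data.Sum using (_⊎_; inj₁; inj₂) renaming (map to ⊎-map)
open import Relation.Binary.PropositionalEquality using (_≡_; refl)
open import Relation.Nullary using (¬_)

∧-≡-true⁻ : ∀ x y → x ∧ y ≡ true → x ≡ true × y ≡ true
∧-≡-true⁻ true true refl = refl , refl

module Properties (A : Set) (τ : A) where
  open Theory A τ

  Act-functional : ∀ {θ a b} → Act θ a → Act θ b → a ≡ b
  Act-functional act-a act-a = refl
  Act-functional (act-dot p) (act-dot q) = Act-functional p q
  Act-functional (act-+l p) (act-+l q) = Act-functional p q
  Act-functional (act-+r p) (act-+r q) = Act-functional p q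
  Act-functional (act-∥l p) (act-∥l q) = Act-functional p q
  Act-functional (act-∥r p) (act-∥r q) = Act-functional p q
  Act-functional (act-⟨⟩ p _) (act-⟨⟩ q _) = Act-functional p q

  Initial⇒WF : ∀ P → Initial P → WF P
  Initial⇒WF 𝟎 _ = wf𝟎
  Initial⇒WF (pre a P) i = wfpre i
  Initial⇒WF (P ⊕ Q) i with ∧-≡-true⁻ (initial P) (initial Q) i
  ... | iP , iQ = wf⊕l (Initial⇒WF P iP) iQ
  Initial⇒WF (par P L h Q) i with ∧-≡-true⁻ (initial P) (initial Q) i
  ... | iP , iQ = wfpar (Initial⇒WF P iP) (Initial⇒WF Q iQ)

  WF-⊕⁻ : ∀ {P Q} → WF (P ⊕ Q) → WF P × WF Q
  WF-⊕⁻ (wf⊕l w i) = w , Initial⇒WF _ i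
  WF-⊕⁻ (wf⊕r i w) = Initial⇒WF _ i , w

  Step-preserves-WF : ∀ {P θ Q} → Step P θ Q → WF P → WF Q
  Step-preserves-WF (s-pre i) _ = wfdone (Initial⇒WF _ i)
  Step-preserves-WF (s-done s) (wfdone w) = wfdone (Step-preserves-WF s w)
  Step-preserves-WF (s-+l s i) w = wf⊕l (Step-preserves-WF s (proj₁ (WF-⊕⁻ w))) i
  Step-preserves-WF (s-+r s i) w = wf⊕r i (Step-preserves-WF s (proj₂ (WF-⊕⁻ w)))
  Step-preserves-WF (s-∥l s _) (wfpar w₁ w₂) = wfpar (Step-preserves-WF s w₁) w₂
  Step-preserves-WF (s-∥r s _) (wfpar w₁ w₂) = wfpar w₁ (Step-preserves-WF s w₂)
  Step-preserves-WF (s-sync s₁ s₂ _ _ _) (wfpar w₁ w₂) =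
    wfpar (Step-preserves-WF s₁ w₁) (Step-preserves-WF s₂ w₂)

  Steps-preserve-WF : ∀ {P Q} → Steps P Q → WF P → WF Q
  Steps-preserve-WF ε w = w
  Steps-preserve-WF (s ◅ ss) w = Steps-preserve-WF ss (Step-preserves-WF s w)

  Reach⇒WF : ∀ {P} → Reach P → WF P
  Reach⇒WF (P₀ , i , ss) = Steps-preserve-WF ss (Initial⇒WF P₀ i)

  sumCase⁻ : ∀ b₁ b₂ {Z X₁ X₂ : ASet} {a} → (Z a → X₁ a ⊎ X₂ a) →
             sumCase b₁ b₂ Z X₁ X₂ a → (X₁ a × b₂ ≡ true) ⊎ (X₂ a × b₁ ≡ true)
  sumCase⁻ true  true  split z = ⊎-map (_, refl) (_, refl) (split z)
  sumCase⁻ false true  _     x = inj₁ (x , refl)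
  sumCase⁻ true  false _     x = inj₂ (x , refl)

  Step-target-not-initial : ∀ {P θ Q} → Step P θ Q → initial Q ≡ false
  Step-target-not-initial (s-pre _) = refl
  Step-target-not-initial (s-done _) = refl
  Step-target-not-initial (s-+l s _) rewrite Step-target-not-initial s = refl
  Step-target-not-initial (s-+r s i) rewrite Step-target-not-initial s | i = refl
  Step-target-not-initial (s-∥l s _) rewrite Step-target-not-initial s = refl
  Step-target-not-initial (s-∥r s _) rewrite Step-target-not-initial s = ∧-zeroʳ _
  Step-target-not-initial (s-sync s _ _ _ _) rewrite Step-target-not-initial s = refl

  _─[_]→_ : Proc → A → Proc → Set₁
  P ─[ a ]→ Q = Σ PT λ θ → Step P θ Q × Act θ a

  ForwardEnabled BackwardEnabled : Proc → A → Set₁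
  ForwardEnabled P a = ∃ λ Q → P ─[ a ]→ Q
  BackwardEnabled P a = ∃ λ Q → Q ─[ a ]→ P

  ─→-done : ∀ {P a b Q} → P ─[ a ]→ Q → done b P ─[ a ]→ done b Q
  ─→-done (θ , s , p) = dot θ , s-done s , act-dot p

  ─→-+l : ∀ {P₁ P₁' P₂ a} → P₁ ─[ a ]→ P₁' → Initial P₂ → (P₁ ⊕ P₂) ─[ a ]→ (P₁' ⊕ P₂)
  ─→-+l (θ , s , p) i = +l θ , s-+l s i , act-+l p

  ─→-+r : ∀ {P₁ P₂ P₂' a} → P₂ ─[ a ]→ P₂' → Initial P₁ → (P₁ ⊕ P₂) ─[ a ]→ (P₁ ⊕ P₂')
  ─→-+r (θ , s , p) i = +r θ , s-+r s i , act-+r p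

  ─→-∥l : ∀ {P₁ P₁' P₂ L h a} → P₁ ─[ a ]→ P₁' → ¬ L a →
          par P₁ L h P₂ ─[ a ]→ par P₁' L h P₂
  ─→-∥l {a = a} (θ , s , p) a∉L = ∥l θ , s-∥l s (a , p , a∉L) , act-∥l p

  ─→-∥r : ∀ {P₁ P₂ P₂' L h a} → P₂ ─[ a ]→ P₂' → ¬ L a →
          par P₁ L h P₂ ─[ a ]→ par P₁ L h P₂'
  ─→-∥r {a = a} (θ , s , p) a∉L = ∥r θ , s-∥r s (a , p , a∉L) , act-∥r p

  ─→-sync : ∀ {P₁ P₁' P₂ P₂' L h a} → P₁ ─[ a ]→ P₁' → P₂ ─[ a ]→ P₂' → L a →
            par P₁ L h P₂ ─[ a ]→ par P₁' L h P₂'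
  ─→-sync (θ₁ , s₁ , p₁) (θ₂ , s₂ , p₂) a∈L =
    ⟨ θ₁ , θ₂ ⟩ , s-sync s₁ s₂ p₁ p₂ a∈L , act-⟨⟩ p₁ p₂

  Step⇒frs : ∀ {P θ Q a} → Step P θ Q → Act θ a → frs P a
  Step⇒frs (s-pre _) act-a = refl
  Step⇒frs (s-done s) (act-dot p) = Step⇒frs s p
  Step⇒frs (s-+l {P₁ = P₁} s i) (act-+l p) rewrite i with initial P₁
  ... | true = inj₁ (Step⇒frs s p)
  ... | false = Step⇒frs s p
  Step⇒frs (s-+r {P₂ = P₂} s i) (act-+r p) rewrite i with initial P₂
  ... | true = inj₂ (Step⇒frs s p)
  ... | false = Step⇒frs s p
  Step⇒frs (s-∥l s (_ , q , b∉L)) (act-∥l p) with Act-functional p q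
  ... | refl = inj₁ (Step⇒frs s p , b∉L)
  Step⇒frs (s-∥r s (_ , q , b∉L)) (act-∥r p) with Act-functional p q
  ... | refl = inj₂ (inj₁ (Step⇒frs s p , b∉L))
  Step⇒frs (s-sync s₁ s₂ q _ b∈L) (act-⟨⟩ p₁ p₂) with Act-functional p₁ q
  ... | refl = inj₂ (inj₂ ((Step⇒frs s₁ p₁ , Step⇒frs s₂ p₂) , b∈L))

  -- Well-formedness is needed only at a prefix a.P, where it makes a.P ─a→ a†.P available.
  frs⇒ForwardEnabled : ∀ P {a} → WF P → frs P a → ForwardEnabled P a
  frs⇒ForwardEnabled (pre b P) (wfpre i) refl = done b P , act b , s-pre i , act-a
  frs⇒ForwardEnabled (done b P) (wfdone w) x = map (done b) ─→-done (frs⇒ForwardEnabled P w x)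
  frs⇒ForwardEnabled (P₁ ⊕ P₂) w x
    with WF-⊕⁻ w | sumCase⁻ (initial P₁) (initial P₂) (λ x → x) x
  ... | w₁ , _ | inj₁ (x₁ , i₂) = map (_⊕ P₂) (λ t → ─→-+l t i₂) (frs⇒ForwardEnabled P₁ w₁ x₁)
  ... | _ , w₂ | inj₂ (x₂ , i₁) = map (P₁ ⊕_) (λ t → ─→-+r t i₁) (frs⇒ForwardEnabled P₂ w₂ x₂)
  frs⇒ForwardEnabled (par P₁ L h P₂) (wfpar w₁ _) (inj₁ (x , a∉L)) =
    map (λ Q → par Q L h P₂) (λ t → ─→-∥l t a∉L) (frs⇒ForwardEnabled P₁ w₁ x)
  frs⇒ForwardEnabled (par P₁ L h P₂) (wfpar _ w₂) (inj₂ (inj₁ (x , a∉L))) =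
    map (par P₁ L h) (λ t → ─→-∥r t a∉L) (frs⇒ForwardEnabled P₂ w₂ x)
  frs⇒ForwardEnabled (par P₁ L h P₂) (wfpar w₁ w₂) (inj₂ (inj₂ ((x₁ , x₂) , a∈L)))
    with frs⇒ForwardEnabled P₁ w₁ x₁ | frs⇒ForwardEnabled P₂ w₂ x₂
  ... | Q₁ , t₁ | Q₂ , t₂ = par Q₁ L h Q₂ , ─→-sync t₁ t₂ a∈L

  Step⇒brs : ∀ {P θ Q a} → Step P θ Q → Act θ a → brs Q a
  Step⇒brs (s-pre i) act-a rewrite i = refl
  Step⇒brs (s-done s) (act-dot p) rewrite Step-target-not-initial s = Step⇒brs s p
  Step⇒brs (s-+l s i) (act-+l p) rewrite Step-target-not-initial s | i = Step⇒brs s p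
  Step⇒brs (s-+r s i) (act-+r p) rewrite Step-target-not-initial s | i = Step⇒brs s p
  Step⇒brs (s-∥l s (_ , q , b∉L)) (act-∥l p) with Act-functional p q
  ... | refl = inj₁ (Step⇒brs s p , b∉L)
  Step⇒brs (s-∥r s (_ , q , b∉L)) (act-∥r p) with Act-functional p q
  ... | refl = inj₂ (inj₁ (Step⇒brs s p , b∉L))
  Step⇒brs (s-sync s₁ s₂ q _ b∈L) (act-⟨⟩ p₁ p₂) with Act-functional p₁ q
  ... | refl = inj₂ (inj₂ ((Step⇒brs s₁ p₁ , Step⇒brs s₂ p₂) , b∈L))

  brs⇒BackwardEnabled : ∀ P {a} → brs P a → BackwardEnabled P a
  brs⇒BackwardEnabled (done b P) x with initial P in i
  brs⇒BackwardEnabled (done b P) refl | true = pre b P , act b , s-pre i , act-a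
  brs⇒BackwardEnabled (done b P) x | false = map (done b) ─→-done (brs⇒BackwardEnabled P x)
  brs⇒BackwardEnabled (P₁ ⊕ P₂) x with sumCase⁻ (initial P₁) (initial P₂) (λ ()) x
  ... | inj₁ (x₁ , i₂) = map (_⊕ P₂) (λ t → ─→-+l t i₂) (brs⇒BackwardEnabled P₁ x₁)
  ... | inj₂ (x₂ , i₁) = map (P₁ ⊕_) (λ t → ─→-+r t i₁) (brs⇒BackwardEnabled P₂ x₂)
  brs⇒BackwardEnabled (par P₁ L h P₂) (inj₁ (x , a∉L)) =
    map (λ Q → par Q L h P₂) (λ t → ─→-∥l t a∉L) (brs⇒BackwardEnabled P₁ x)
  brs⇒BackwardEnabled (par P₁ L h P₂) (inj₂ (inj₁ (x , a∉L))) =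
    map (par P₁ L h) (λ t → ─→-∥r t a∉L) (brs⇒BackwardEnabled P₂ x)
  brs⇒BackwardEnabled (par P₁ L h P₂) (inj₂ (inj₂ ((x₁ , x₂) , a∈L)))
    with brs⇒BackwardEnabled P₁ x₁ | brs⇒BackwardEnabled P₂ x₂
  ... | Q₁ , t₁ | Q₂ , t₂ = par Q₁ L h Q₂ , ─→-sync t₁ t₂ a∈L

  ForwardClause⇒ForwardEnabled : ∀ {B P₁ P₂ a} → ForwardClause B → B P₁ P₂ →
                                 ForwardEnabled P₁ a → ForwardEnabled P₂ a
  ForwardClause⇒ForwardEnabled F b (_ , _ , s₁ , p₁) with F b s₁
  ... | θ₂ , P₂' , s₂ , (_ , q₁ , q₂) , _ with Act-functional p₁ q₁
  ... | refl = P₂' , θ₂ , s₂ , q₂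

  ReverseClause⇒BackwardEnabled : ∀ {B P₁ P₂ a} → ReverseClause B → B P₁ P₂ →
                                  BackwardEnabled P₁ a → BackwardEnabled P₂ a
  ReverseClause⇒BackwardEnabled R b (_ , _ , s₁ , p₁) with R b s₁
  ... | θ₂ , P₂' , s₂ , (_ , q₁ , q₂) , _ with Act-functional p₁ q₁
  ... | refl = P₂' , θ₂ , s₂ , q₂

  IsFB⇒frs-≐ : ∀ {B P₁ P₂} → IsFB B → B P₁ P₂ → frs P₁ ≐ frs P₂
  IsFB⇒frs-≐ {B} ((onReach , sym) , F) b a =
    transfer b (proj₁ (onReach b)) , transfer (sym b) (proj₂ (onReach b))
    where
    transfer : ∀ {P Q} → B P Q → Reach P → frs P a → frs Q a
    transfer b r x with ForwardClause⇒ForwardEnabled F b (frs⇒ForwardEnabled _ (Reach⇒WF r) x)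
    ... | _ , _ , s , p = Step⇒frs s p

  IsRB⇒brs-≐ : ∀ {B P₁ P₂} → IsRB B → B P₁ P₂ → brs P₁ ≐ brs P₂
  IsRB⇒brs-≐ {B} ((_ , sym) , R) b a = transfer b , transfer (sym b)
    where
    transfer : ∀ {P Q} → B P Q → brs P a → brs Q a
    transfer b x with ReverseClause⇒BackwardEnabled R b (brs⇒BackwardEnabled _ x)
    ... | _ , _ , s , p = Step⇒brs s p

proposition1 : (A : Set) (τ : A) → Countable A →
    let open Theory A τ in
    (P₁ P₂ : Proc) → Reach P₁ → Reach P₂ →
    (((P₁ ∼FB P₂) ⊎ ((P₁ ∼FBps P₂) ⊎ (P₁ ∼FRB P₂))) → frs P₁ ≐ frs P₂) ×
    (((P₁ ∼RB P₂) ⊎ (P₁ ∼FRB P₂)) → brs P₁ ≐ brs P₂)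
proposition1 A τ _ P₁ P₂ _ _ = frs-≐ , brs-≐
  where
  open Theory A τ
  open Properties A τ

  frs-≐ : (P₁ ∼FB P₂) ⊎ ((P₁ ∼FBps P₂) ⊎ (P₁ ∼FRB P₂)) → frs P₁ ≐ frs P₂
  frs-≐ (inj₁ (_ , fb , b)) = IsFB⇒frs-≐ fb b
  frs-≐ (inj₂ (inj₁ (_ , (fb , _) , b))) = IsFB⇒frs-≐ fb b
  frs-≐ (inj₂ (inj₂ (_ , (r , f , _) , b))) = IsFB⇒frs-≐ (r , f) b

  brs-≐ : (P₁ ∼RB P₂) ⊎ (P₁ ∼FRB P₂) → brs P₁ ≐ brs P₂
  brs-≐ (inj₁ (_ , rb , b)) = IsRB⇒brs-≐ rb b
  brs-≐ (inj₂ (_ , (r , _ , rc) , b)) = IsRB⇒brs-≐ (r , rc) b
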